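{- The relation $\sim$ on $n$PC formulas, defined by $F\sim G$ iff for every $i\in\{1,\dots,n\}$ both $F\vdash_i G$ and $G\vdash_i F$ are provable in $n$PC, is an equivalence relation.
   Context: Fix $n\ge 2$, write $\hat n=\{1,\dots,n\}$, let $S_n$ be the group of permutations of $\hat n$ and $V$ a countable set of propositional variables. Formulas of $n$PC are: decorated variables $X^\pi$ ($X\in V$, $\pi\in S_n$); constants $\mathsf e_1,\dots,\mathsf e_n$; compound formulas $q(F,G_1,\dots,G_n)$. For $\rho\in S_n$, $F^\rho$ is defined by $(X^\pi)^\rho=X^{\rho\circ\pi}$, $(\mathsf e_k)^\rho=\mathsf e_{\rho(k)}$, $q(F,G_1,\dots,G_n)^\rho=q(F,G_1^\rho,\dots,G_n^\rho)$. $(ij)$ denotes the transposition exchanging $i$ and $j$ (identity if $i=j$). Contexts $\Gamma,\Delta$ are finite multisets of formulas, $\Gamma^\rho$ elementwise. Sequents $\Gamma\vdash_i\Delta$ ($i\in\hat n$) are provable if derivable by the rules (premises $\Rightarrow$ conclusion), for all $i,j,k\in\hat n$: (Const) $\Rightarrow\ \vdash_i\mathsf e_i$. (Id) $\Rightarrow X^\pi\vdash_i X^\rho$ whenever $\pi^{ -1}(i)=\rho^{ -1}(i)$. (Sym) $\Gamma^{(ij)}\vdash_i\Delta^{(ij)}\Rightarrow\Gamma\vdash_j\Delta$. (Neg1) if $i\ne k$: $\Gamma^{(ij)}\vdash_i F,\Delta^{(ij)}\Rightarrow \Gamma,F^{(jk)}\vdash_j\Delta$. (Neg2) if $j\neq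 k$: $\Gamma^{(ij)}\vdash_i F,\Delta^{(ij)}\Rightarrow \Gamma,F^{(ik)}\vdash_j\Delta$. (Neg3) $\{\Gamma^{(ij)},F\vdash_i\Delta^{(ij)}\}_{i\neq j}\Rightarrow\Gamma\vdash_j F,\Delta$. (qL) $\{\Gamma^{(ji)},F,G_j^{(ji)}\vdash_j\Delta^{(ji)}\}_{j\in\hat n}\Rightarrow \Gamma,q(F,G_1,\dots,G_n)\vdash_i\Delta$. (qR) $\{\Gamma^{(ji)},F\vdash_j G_j^{(ji)},\Delta^{(ji)}\}_{j\in\hat n}\Rightarrow\Gamma\vdash_i q(F,G_1,\dots,G_n),\Delta$. (Cut) $\Gamma,F\vdash_i\Delta$ and $\Gamma\vdash_i F,\Delta\Rightarrow\Gamma\vdash_i\Delta$. Left and right weakening and contraction in each $\vdash_i$. -}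

module Defs where

open import Data.Nat.Base using (ℕ)
open import Data.Fin.Base using (Fin)
open import Data.Fin.Permutation using (Permutation′; _⟨$⟩ʳ_; _⟨$⟩ˡ_; _∘ₚ_; transpose)
open import Data.List.Base using (List; []; _∷_; map)
open import Data.List.Relation.Binary.Permutation.Propositional using (_↭_)
open import Data.Product.Base using (_×_)
open import Relation.Binary.PropositionalEquality using (_≡_; _≢_)

data Formula (n : ℕ) : Set where
  var : ℕ → Permutation′ n → Formula n
  e   : Fin n → Formula n
  q   : Formula n → (Fin n → Formula n) → Formula n

-- composition in math order:  ρ ∘ π  (apply π first, then ρ)
_○_ : ∀ {n} → Permutation′ n → Permutation′ n → Permutation′ n
ρ ○ π = π ∘ₚ ρ

_^_ : ∀ {n} → Formula n → Permutation′ n → Formula n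
var X π ^ ρ = var X (ρ ○ π)
e k     ^ ρ = e (ρ ⟨$⟩ʳ k)
q F G   ^ ρ = q F (λ k → G k ^ ρ)

-- transposition (i j); stdlib's transpose i i is the identity
⟨_⸴_⟩ : ∀ {n} → Fin n → Fin n → Permutation′ n
⟨ i ⸴ j ⟩ = transpose i j

-- contexts (multisets, represented as lists up to permutation via the exchange rules)
Ctx : ℕ → Set
Ctx n = List (Formula n)

_^ᶜ_ : ∀ {n} → Ctx n → Permutation′ n → Ctx n
Γ ^ᶜ ρ = map (_^ ρ) Γ

data _⊢[_]_ {n : ℕ} : Ctx n → Fin n → Ctx n → Set where
  const : ∀ {i} → [] ⊢[ i ] (e i ∷ [])
  ax    : ∀ {i X π ρ} → (π ⟨$⟩ˡ i) ≡ (ρ ⟨$⟩ˡ i) →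
          (var X π ∷ []) ⊢[ i ] (var X ρ ∷ [])
  sym   : ∀ {i j Γ Δ} → (Γ ^ᶜ ⟨ i ⸴ j ⟩) ⊢[ i ] (Δ ^ᶜ ⟨ i ⸴ j ⟩) → Γ ⊢[ j ] Δ
  neg1  : ∀ {i j k Γ Δ F} → i ≢ k →
          (Γ ^ᶜ ⟨ i ⸴ j ⟩) ⊢[ i ] (F ∷ (Δ ^ᶜ ⟨ i ⸴ j ⟩)) →
          ((F ^ ⟨ j ⸴ k ⟩) ∷ Γ) ⊢[ j ] Δ
  neg2  : ∀ {i j k Γ Δ F} → j ≢ k →
          (Γ ^ᶜ ⟨ i ⸴ j ⟩) ⊢[ i ] (F ∷ (Δ ^ᶜ ⟨ i ⸴ j ⟩)) →
          ((F ^ ⟨ i ⸴ k ⟩) ∷ Γ) ⊢[ j ] Δ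
  neg3  : ∀ {j Γ Δ F} →
          (∀ i → i ≢ j → (F ∷ (Γ ^ᶜ ⟨ i ⸴ j ⟩)) ⊢[ i ] (Δ ^ᶜ ⟨ i ⸴ j ⟩)) →
          Γ ⊢[ j ] (F ∷ Δ)
  qL    : ∀ {i Γ Δ F G} →
          (∀ j → (F ∷ (G j ^ ⟨ j ⸴ i ⟩) ∷ (Γ ^ᶜ ⟨ j ⸴ i ⟩)) ⊢[ j ] (Δ ^ᶜ ⟨ j ⸴ i ⟩)) →
          (q F G ∷ Γ) ⊢[ i ] Δ
  qR    : ∀ {i Γ Δ F G} →
          (∀ j → (F ∷ (Γ ^ᶜ ⟨ j ⸴ i ⟩)) ⊢[ j ] ((G j ^ ⟨ j ⸴ i ⟩) ∷ (Δ ^ᶜ ⟨ j ⸴ i ⟩))) →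
          Γ ⊢[ i ] (q F G ∷ Δ)
  cut   : ∀ {i Γ Δ F} → (F ∷ Γ) ⊢[ i ] Δ → Γ ⊢[ i ] (F ∷ Δ) → Γ ⊢[ i ] Δ
  weakL : ∀ {i Γ Δ F} → Γ ⊢[ i ] Δ → (F ∷ Γ) ⊢[ i ] Δ
  weakR : ∀ {i Γ Δ F} → Γ ⊢[ i ] Δ → Γ ⊢[ i ] (F ∷ Δ)
  contrL : ∀ {i Γ Δ F} → (F ∷ F ∷ Γ) ⊢[ i ] Δ → (F ∷ Γ) ⊢[ i ] Δ
  contrR : ∀ {i Γ Δ F} → Γ ⊢[ i ] (F ∷ F ∷ Δ) → Γ ⊢[ i ] (F ∷ Δ)
  exchL : ∀ {i Γ Γ′ Δ} → Γ ↭ Γ′ → Γ ⊢[ i ] Δ → Γ′ ⊢[ i ] Δ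
  exchR : ∀ {i Γ Δ Δ′} → Δ ↭ Δ′ → Γ ⊢[ i ] Δ → Γ ⊢[ i ] Δ′

_∼_ : ∀ {n} → Formula n → Formula n → Set
F ∼ G = ∀ i → ((F ∷ []) ⊢[ i ] (G ∷ [])) × ((G ∷ []) ⊢[ i ] (F ∷ []))

module Submission where

open import Defs
open import Data.Nat.Base using (ℕ; _≤_)
open import Relation.Binary.Structures using (IsEquivalence)

open import Data.Empty using (⊥-elim)
open import Data.Fin.Base using (Fin)
open import Data.Fin.Properties using (_≟_)
open import Data.Fin.Permutation using (Permutation′; _⟨$⟩ʳ_; _⟨$⟩ˡ_; inverseˡ; inverseʳ)
import Data.Fin.Permutation.Components as PC
open import Data.List.Base using (List; []; _∷_)
open import Data.List.Relation.Binary.Permutation.Propositional using (↭-refl; ↭-swap)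
open import Data.Product.Base using (_,_; proj₁; proj₂)
open import Relation.Binary.PropositionalEquality
  using (_≡_; _≢_; refl; cong; subst; module ≡-Reasoning)
  renaming (sym to ≡-sym; trans to ≡-trans)
open import Relation.Nullary using (yes; no)

-- Reflexivity of ∼ is proved through the stronger, inductive statement that
-- F^σ ⊢ᵢ F^τ whenever σ⁻¹(i) = τ⁻¹(i): applying (qR) and then (qL) to
-- q(F, G) leaves the components G_j twisted by two more transpositions, so the
-- induction must allow arbitrary composites σ, τ.  As the action ^ is not
-- definitionally a group action, σ and τ are kept as lists of permutations
-- applied one after another.  Transitivity is a cut.

module _ {n : ℕ} where

  transpose-refl : (i k : Fin n) → PC.transpose i i k ≡ k
  transpose-refl i k with k ≟ i
  ... | yes k≡i = ≡-sym k≡i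
  ... | no _ with k ≟ i
  ...   | yes k≡i = ≡-sym k≡i
  ...   | no _ = refl

  transpose-snd : (i j : Fin n) → PC.transpose i j j ≡ i
  transpose-snd i j with j ≟ i
  ... | yes j≡i = j≡i
  ... | no _ with j ≟ j
  ...   | yes _ = refl
  ...   | no j≢j = ⊥-elim (j≢j refl)

  -- Iterated action: the head of the list is applied last.

  _^⋆_ : Formula n → List (Permutation′ n) → Formula n
  F ^⋆ []       = F
  F ^⋆ (ρ ∷ ρs) = (F ^⋆ ρs) ^ ρ

  _○⋆_ : List (Permutation′ n) → Permutation′ n → Permutation′ n
  []       ○⋆ π = π
  (ρ ∷ ρs) ○⋆ π = ρ ○ (ρs ○⋆ π)

  _⟨$⟩ʳ⋆_ : List (Permutation′ n) → Fin n → Fin n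
  []       ⟨$⟩ʳ⋆ k = k
  (ρ ∷ ρs) ⟨$⟩ʳ⋆ k = ρ ⟨$⟩ʳ (ρs ⟨$⟩ʳ⋆ k)

  _⟨$⟩ˡ⋆_ : List (Permutation′ n) → Fin n → Fin n
  []       ⟨$⟩ˡ⋆ i = i
  (ρ ∷ ρs) ⟨$⟩ˡ⋆ i = ρs ⟨$⟩ˡ⋆ (ρ ⟨$⟩ˡ i)

  inverseˡ⋆ : ∀ ρs {k} → ρs ⟨$⟩ˡ⋆ (ρs ⟨$⟩ʳ⋆ k) ≡ k
  inverseˡ⋆ []       = refl
  inverseˡ⋆ (ρ ∷ ρs) = ≡-trans (cong (ρs ⟨$⟩ˡ⋆_) (inverseˡ ρ)) (inverseˡ⋆ ρs)

  inverseʳ⋆ : ∀ ρs {i} → ρs ⟨$⟩ʳ⋆ (ρs ⟨$⟩ˡ⋆ i) ≡ i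
  inverseʳ⋆ []       = refl
  inverseʳ⋆ (ρ ∷ ρs) = ≡-trans (cong (ρ ⟨$⟩ʳ_) (inverseʳ⋆ ρs)) (inverseʳ ρ)

  ○⋆-⟨$⟩ˡ : ∀ ρs π i → (ρs ○⋆ π) ⟨$⟩ˡ i ≡ π ⟨$⟩ˡ (ρs ⟨$⟩ˡ⋆ i)
  ○⋆-⟨$⟩ˡ []       π i = refl
  ○⋆-⟨$⟩ˡ (ρ ∷ ρs) π i = ○⋆-⟨$⟩ˡ ρs π (ρ ⟨$⟩ˡ i)

  ^⋆-var : ∀ ρs X π → var X π ^⋆ ρs ≡ var X (ρs ○⋆ π)
  ^⋆-var []       X π = refl
  ^⋆-var (ρ ∷ ρs) X π = cong (_^ ρ) (^⋆-var ρs X π)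

  ^⋆-e : ∀ ρs k → e k ^⋆ ρs ≡ e (ρs ⟨$⟩ʳ⋆ k)
  ^⋆-e []       k = refl
  ^⋆-e (ρ ∷ ρs) k = cong (_^ ρ) (^⋆-e ρs k)

  ^⋆-q : ∀ ρs F G → q F G ^⋆ ρs ≡ q F (λ k → G k ^⋆ ρs)
  ^⋆-q []       F G = refl
  ^⋆-q (ρ ∷ ρs) F G = cong (_^ ρ) (^⋆-q ρs F G)

  ⟨$⟩ʳ⋆-transfer : ∀ ρs σs {i k} → ρs ⟨$⟩ˡ⋆ i ≡ σs ⟨$⟩ˡ⋆ i →
                   ρs ⟨$⟩ʳ⋆ k ≡ i → σs ⟨$⟩ʳ⋆ k ≡ i
  ⟨$⟩ʳ⋆-transfer ρs σs {i} {k} ρs≈σs ρs[k]≡i = begin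
    σs ⟨$⟩ʳ⋆ k                        ≡⟨ cong (σs ⟨$⟩ʳ⋆_) (≡-sym (inverseˡ⋆ ρs)) ⟩
    σs ⟨$⟩ʳ⋆ (ρs ⟨$⟩ˡ⋆ (ρs ⟨$⟩ʳ⋆ k))  ≡⟨ cong (λ x → σs ⟨$⟩ʳ⋆ (ρs ⟨$⟩ˡ⋆ x)) ρs[k]≡i ⟩
    σs ⟨$⟩ʳ⋆ (ρs ⟨$⟩ˡ⋆ i)             ≡⟨ cong (σs ⟨$⟩ʳ⋆_) ρs≈σs ⟩
    σs ⟨$⟩ʳ⋆ (σs ⟨$⟩ˡ⋆ i)             ≡⟨ inverseʳ⋆ σs ⟩
    i                                ∎
    where open ≡-Reasoning

  swapL : ∀ {i : Fin n} {A B Γ Δ} → (A ∷ B ∷ Γ) ⊢[ i ] Δ → (B ∷ A ∷ Γ) ⊢[ i ] Δ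
  swapL = exchL (↭-swap _ _ ↭-refl)

  swapR : ∀ {i : Fin n} {Γ A B Δ} → Γ ⊢[ i ] (A ∷ B ∷ Δ) → Γ ⊢[ i ] (B ∷ A ∷ Δ)
  swapR = exchR (↭-swap _ _ ↭-refl)

  constant-refutes : ∀ {k i} → k ≢ i → (e k ∷ []) ⊢[ i ] []
  constant-refutes {k} {i} k≢i =
    subst (λ x → (e x ∷ []) ⊢[ i ] []) (transpose-refl i k)
      (neg1 {i = k} {j = i} {k = i} {Γ = []} {Δ = []} k≢i const)

  twisted-identity : ∀ F ρs σs i → ρs ⟨$⟩ˡ⋆ i ≡ σs ⟨$⟩ˡ⋆ i →
                     (F ^⋆ ρs ∷ []) ⊢[ i ] (F ^⋆ σs ∷ [])
  twisted-identity (var X π) ρs σs i ρs≈σs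
    rewrite ^⋆-var ρs X π | ^⋆-var σs X π = ax (begin
      (ρs ○⋆ π) ⟨$⟩ˡ i   ≡⟨ ○⋆-⟨$⟩ˡ ρs π i ⟩
      π ⟨$⟩ˡ (ρs ⟨$⟩ˡ⋆ i) ≡⟨ cong (π ⟨$⟩ˡ_) ρs≈σs ⟩
      π ⟨$⟩ˡ (σs ⟨$⟩ˡ⋆ i) ≡⟨ ≡-sym (○⋆-⟨$⟩ˡ σs π i) ⟩
      (σs ○⋆ π) ⟨$⟩ˡ i   ∎)
    where open ≡-Reasoning
  twisted-identity (e k) ρs σs i ρs≈σs
    rewrite ^⋆-e ρs k | ^⋆-e σs k with ρs ⟨$⟩ʳ⋆ k ≟ i
  ... | no ρs[k]≢i  = weakR (constant-refutes ρs[k]≢i)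
  ... | yes ρs[k]≡i
    rewrite ρs[k]≡i | ⟨$⟩ʳ⋆-transfer ρs σs ρs≈σs ρs[k]≡i = weakL const
  twisted-identity (q F G) ρs σs i ρs≈σs
    rewrite ^⋆-q ρs F G | ^⋆-q σs F G = qR (λ j → swapL (qL (component j)))
    where
    component : ∀ j m →
      (F ∷ G m ^⋆ (⟨ m ⸴ j ⟩ ∷ ⟨ j ⸴ i ⟩ ∷ ρs) ∷ F ^ ⟨ m ⸴ j ⟩ ∷ []) ⊢[ m ]
      (G j ^⋆ (⟨ m ⸴ j ⟩ ∷ ⟨ j ⸴ i ⟩ ∷ σs) ∷ [])
    component j m with m ≟ j
    ... | yes refl = weakL (swapL (weakL
          (twisted-identity (G m) (⟨ m ⸴ m ⟩ ∷ ⟨ m ⸴ i ⟩ ∷ ρs) (⟨ m ⸴ m ⟩ ∷ ⟨ m ⸴ i ⟩ ∷ σs) m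
            (subst (λ x → ρs ⟨$⟩ˡ⋆ x ≡ σs ⟨$⟩ˡ⋆ x) (≡-sym twist-back) ρs≈σs))))
      where
      twist-back : PC.transpose i m (PC.transpose m m m) ≡ i
      twist-back = ≡-trans (cong (PC.transpose i m) (transpose-refl m m)) (transpose-snd i m)
    -- F together with its twist F^(m j) is contradictory at m, by (Neg1) on F ⊢ₘ F.
    ... | no m≢j = swapL (weakL (swapL (weakR
          (neg1 {k = j} {Γ = F ∷ []} {Δ = []} m≢j
            (twisted-identity F (⟨ m ⸴ m ⟩ ∷ []) [] m (transpose-refl m m))))))

  identity : ∀ F i → (F ∷ []) ⊢[ i ] (F ∷ [])
  identity F i = twisted-identity F [] [] i refl

  cut-single : ∀ {i : Fin n} {A B C} → (A ∷ []) ⊢[ i ] (B ∷ []) → (B ∷ []) ⊢[ i ] (C ∷ []) →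
               (A ∷ []) ⊢[ i ] (C ∷ [])
  cut-single A⊢B B⊢C = cut (swapL (weakL B⊢C)) (swapR (weakR A⊢B))

lemma4p2 : (n : ℕ) → 2 ≤ n → IsEquivalence (_∼_ {n})
lemma4p2 _ _ = record
  { refl  = λ {F} i → identity F i , identity F i
  ; sym   = λ F∼G i → proj₂ (F∼G i) , proj₁ (F∼G i)
  ; trans = λ F∼G G∼H i → cut-single (proj₁ (F∼G i)) (proj₁ (G∼H i))
                        , cut-single (proj₂ (G∼H i)) (proj₂ (F∼G i))
  }
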